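{- Let $v\ge0$ be an integer, $k=2^v$, and $f:\{0,1,\ldots,k-1\}\to\{ -1,1\}$ any function. Suppose that for every integer $v'$ with $0\le v'\le v$ and every arithmetic progression $A\subseteq\{0,1,\ldots,k-1\}$ with $2^{v-v'}$ terms and common difference $2^{v'}$, we have $\sum_{j\in A}f(j)\ne0$. Then $f$ is constant, i.e. either $f(j)=-1$ for all $j$ or $f(j)=1$ for all $j$. -}

module Defs where

open import Data.Nat using (ℕ; zero; suc; _+_; _*_; _<?_)
open import Data.Fin using (Fin; fromℕ<)
open import Data.Integer using (ℤ; 0ℤ) renaming (_+_ to _+ℤ_)
open import Relation.Nullary using (yes; no)

-- Evaluate f : Fin k → ℤ at a natural number j; returns 0 when j ≥ k.
-- (Only ever used at indices proven to be < k in the statement.)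
at : {k : ℕ} → (Fin k → ℤ) → ℕ → ℤ
at {k} f j with j <? k
... | yes j<k = f (fromℕ< j<k)
... | no _ = 0ℤ

sumTo : ℕ → (ℕ → ℤ) → ℤ
sumTo zero g = 0ℤ
sumTo (suc m) g = sumTo m g +ℤ g m

apSum : {k : ℕ} → (Fin k → ℤ) → (a d m : ℕ) → ℤ
apSum f a d m = sumTo m (λ i → at f (a + i * d))

-- The hypothesis for progressions of
-- difference 2^(v′+1) is exactly the hypothesis for the two subsequences
-- f(2j) and f(2j+1) with difference 2^v′, so both are constant. If their
-- constants differed they would cancel in pairs, making the sum over the whole
-- interval (the case v′ = 0) vanish; hence they agree.
module Submission where

open import Defs
open import Data.Nat using (ℕ; zero; suc; _+_; _*_; _∸_; _^_; _≤_; _<_; _<?_; z≤n; s≤s; z<s)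
open import Data.Nat.Properties
open import Data.Nat.DivMod using (_%_; _/_; m≡m%n+[m/n]*n; m%n<n; m<n*o⇒m/o<n)
open import Data.Nat.Tactic.RingSolver using (solve-∀)
open import Data.Fin using (Fin; toℕ; fromℕ<)
open import Data.Fin.Properties using (toℕ<n; fromℕ<-toℕ)
open import Data.Integer using (ℤ; 0ℤ; 1ℤ; -1ℤ) renaming (_+_ to _+ℤ_)
import Data.Integer.Properties as ℤ
open import Data.Sum as Sum using (_⊎_; inj₁; inj₂)
open import Data.Empty using (⊥-elim)
open import Function using (_∘_)
open import Relation.Nullary using (yes; no)
open import Relation.Binary.PropositionalEquality

at-fromℕ< : ∀ {k} (f : Fin k → ℤ) {i} (i<k : i < k) → at f i ≡ f (fromℕ< i<k)
at-fromℕ< {k} f {i} i<k with i <? k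
... | yes i<k′ = cong (λ p → f (fromℕ< p)) (<-irrelevant i<k′ i<k)
... | no i≮k = ⊥-elim (i≮k i<k)

at-toℕ : ∀ {k} (f : Fin k → ℤ) j → at f (toℕ j) ≡ f j
at-toℕ f j = trans (at-fromℕ< f (toℕ<n j)) (cong f (fromℕ<-toℕ j (toℕ<n j)))

sumTo-cong : ∀ m {g h : ℕ → ℤ} → (∀ i → i < m → g i ≡ h i) → sumTo m g ≡ sumTo m h
sumTo-cong zero    g≗h = refl
sumTo-cong (suc m) g≗h =
  cong₂ _+ℤ_ (sumTo-cong m (λ i i<m → g≗h i (m<n⇒m<1+n i<m))) (g≗h m ≤-refl)

sumTo-pairs-cancel : ∀ m (g : ℕ → ℤ) → (∀ p → p < m → g (2 * p) +ℤ g (1 + 2 * p) ≡ 0ℤ) →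
                     sumTo (2 * m) g ≡ 0ℤ
sumTo-pairs-cancel zero    g cancel = refl
sumTo-pairs-cancel (suc m) g cancel = begin
  sumTo (2 * suc m) g                               ≡⟨ cong (λ n → sumTo n g) (*-suc 2 m) ⟩
  sumTo (2 + 2 * m) g                               ≡⟨ ℤ.+-assoc (sumTo (2 * m) g) _ _ ⟩
  sumTo (2 * m) g +ℤ (g (2 * m) +ℤ g (1 + 2 * m))  ≡⟨ cong₂ _+ℤ_ earlier (cancel m ≤-refl) ⟩
  0ℤ                                                ∎
  where
  open ≡-Reasoning
  earlier : sumTo (2 * m) g ≡ 0ℤ
  earlier = sumTo-pairs-cancel m g (λ p p<m → cancel p (m<n⇒m<1+n p<m))

IsSign : ℤ → Set
IsSign x = x ≡ -1ℤ ⊎ x ≡ 1ℤ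

sign-+≢0⇒≡ : ∀ {x y} → IsSign x → IsSign y → x +ℤ y ≢ 0ℤ → x ≡ y
sign-+≢0⇒≡ (inj₁ refl) (inj₁ refl) _   = refl
sign-+≢0⇒≡ (inj₁ refl) (inj₂ refl) x+y≢0 = ⊥-elim (x+y≢0 refl)
sign-+≢0⇒≡ (inj₂ refl) (inj₁ refl) x+y≢0 = ⊥-elim (x+y≢0 refl)
sign-+≢0⇒≡ (inj₂ refl) (inj₂ refl) _   = refl

+-*-< : ∀ {r d x n} → r < d → x < n → r + d * x < d * n
+-*-< {r} {d} {x} {n} r<d x<n = begin-strict
  r + d * x  <⟨ +-monoˡ-< (d * x) r<d ⟩
  d + d * x  ≡⟨ *-suc d x ⟨
  d * suc x  ≤⟨ *-monoʳ-≤ d x<n ⟩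
  d * n      ∎
  where open ≤-Reasoning

DyadicAPSumsNonzero : ℕ → (ℕ → ℤ) → Set
DyadicAPSumsNonzero v g = ∀ v′ a → v′ ≤ v → a + (2 ^ (v ∸ v′) ∸ 1) * 2 ^ v′ < 2 ^ v →
  sumTo (2 ^ (v ∸ v′)) (λ i → g (a + i * 2 ^ v′)) ≢ 0ℤ

everyOther : ℕ → (ℕ → ℤ) → ℕ → ℤ
everyOther r g j = g (r + 2 * j)

r+2*[a+i*d]≡r+2*a+i*[2*d] : ∀ r a i d → r + 2 * (a + i * d) ≡ r + 2 * a + i * (2 * d)
r+2*[a+i*d]≡r+2*a+i*[2*d] = solve-∀

everyOther-dyadic : ∀ {v g} r → r < 2 → DyadicAPSumsNonzero (suc v) g →
                    DyadicAPSumsNonzero v (everyOther r g)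
everyOther-dyadic {v} {g} r r<2 H v′ a v′≤v last<2^v sum≡0 =
  H (suc v′) (r + 2 * a) (s≤s v′≤v) last<2^[1+v] (trans (sym reindex) sum≡0)
  where
  reindex : sumTo (2 ^ (v ∸ v′)) (λ i → everyOther r g (a + i * 2 ^ v′))
          ≡ sumTo (2 ^ (v ∸ v′)) (λ i → g (r + 2 * a + i * 2 ^ suc v′))
  reindex = sumTo-cong (2 ^ (v ∸ v′))
    (λ i _ → cong g (r+2*[a+i*d]≡r+2*a+i*[2*d] r a i (2 ^ v′)))
  last<2^[1+v] : r + 2 * a + (2 ^ (v ∸ v′) ∸ 1) * 2 ^ suc v′ < 2 ^ suc v
  last<2^[1+v] = subst (_< 2 ^ suc v)
    (r+2*[a+i*d]≡r+2*a+i*[2*d] r a (2 ^ (v ∸ v′) ∸ 1) (2 ^ v′)) (+-*-< r<2 last<2^v)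

dyadic⇒constant : ∀ v (g : ℕ → ℤ) → (∀ i → i < 2 ^ v → IsSign (g i)) →
                  DyadicAPSumsNonzero v g → ∀ i → i < 2 ^ v → g i ≡ g 0
dyadic⇒constant zero    g sign H .0 (s≤s z≤n) = refl
dyadic⇒constant (suc v) g sign H i i<2^[1+v] = begin
  g i                           ≡⟨ cong g i≡i%2+2*[i/2] ⟩
  g (i % 2 + 2 * (i / 2))       ≡⟨ half-constant (m%n<n i 2) (i / 2) i/2<2^v ⟩
  g (i % 2 + 2 * 0)             ≡⟨ residue-constant (m%n<n i 2) ⟩
  g 0                           ∎
  where
  open ≡-Reasoning
  N : ℕ
  N = 2 ^ v

  half-constant : ∀ {r} → r < 2 → ∀ j → j < N → g (r + 2 * j) ≡ g (r + 2 * 0)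
  half-constant {r} r<2 = dyadic⇒constant v (everyOther r g)
    (λ j j<N → sign (r + 2 * j) (+-*-< r<2 j<N)) (everyOther-dyadic {g = g} r r<2 H)

  whole-sum≡0 : g 0 +ℤ g 1 ≡ 0ℤ → sumTo (2 * N) (λ i → g (i * 1)) ≡ 0ℤ
  whole-sum≡0 g₀+g₁≡0 = trans (sumTo-cong (2 * N) (λ i _ → cong g (*-identityʳ i)))
    (sumTo-pairs-cancel N g (λ p p<N →
      trans (cong₂ _+ℤ_ (half-constant z<s p p<N) (half-constant (s≤s z<s) p p<N)) g₀+g₁≡0))

  last<2N : (2 * N ∸ 1) * 1 < 2 * N
  last<2N = subst (_< 2 * N) (sym (*-identityʳ _)) (∸-monoʳ-< z<s (m^n>0 2 (suc v)))

  g₁≡g₀ : g 1 ≡ g 0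
  g₁≡g₀ = sym (sign-+≢0⇒≡ (sign 0 (m^n>0 2 (suc v))) (sign 1 (*-monoʳ-≤ 2 (m^n>0 2 v)))
                           (H 0 0 z≤n last<2N ∘ whole-sum≡0))

  residue-constant : ∀ {r} → r < 2 → g (r + 2 * 0) ≡ g 0
  residue-constant (s≤s z≤n)       = refl
  residue-constant (s≤s (s≤s z≤n)) = g₁≡g₀

  i≡i%2+2*[i/2] : i ≡ i % 2 + 2 * (i / 2)
  i≡i%2+2*[i/2] = trans (m≡m%n+[m/n]*n i 2) (cong (i % 2 +_) (*-comm (i / 2) 2))

  i/2<2^v : i / 2 < N
  i/2<2^v = m<n*o⇒m/o<n (subst (i <_) (*-comm 2 N) i<2^[1+v])

proposition3p7 : (v : ℕ) → (f : Fin (2 ^ v) → ℤ) →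
    (∀ j → f j ≡ -1ℤ ⊎ f j ≡ 1ℤ) →
    (∀ (v′ a : ℕ) → v′ ≤ v →
      a + (2 ^ (v ∸ v′) ∸ 1) * 2 ^ v′ < 2 ^ v →
      apSum f a (2 ^ v′) (2 ^ (v ∸ v′)) ≢ 0ℤ) →
    (∀ j → f j ≡ -1ℤ) ⊎ (∀ j → f j ≡ 1ℤ)
proposition3p7 v f sign H =
  Sum.map (λ f₀≡-1 j → trans (f≡f₀ j) f₀≡-1) (λ f₀≡1 j → trans (f≡f₀ j) f₀≡1)
          (sign-at 0 (m^n>0 2 v))
  where
  sign-at : ∀ i → i < 2 ^ v → IsSign (at f i)
  sign-at i i<2^v = subst IsSign (sym (at-fromℕ< f i<2^v)) (sign _)

  f≡f₀ : ∀ j → f j ≡ at f 0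
  f≡f₀ j = trans (sym (at-toℕ f j)) (dyadic⇒constant v (at f) sign-at H (toℕ j) (toℕ<n j))
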